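{- Let $G$ be a finite abelian group of odd order, let $S \subseteq G$ be a symmetric subset (i.e.\ $-s \in S$ for all $s \in S$), and let $X = \operatorname{Cay}(G;S)$. Suppose $X$ is connected and twin-free. Then $\operatorname{Aut}(BX) = \operatorname{Aut} X \times S_2$; that is, every automorphism of $BX$ is of the form $(v,i) \mapsto (\alpha(v), \sigma(i))$ for some $\alpha \in \operatorname{Aut} X$ and some permutation $\sigma$ of $\{0,1\}$.
   Context: Graphs are undirected, without multiple edges; loops are allowed. For an abelian group $G$ and a symmetric subset $S$, the Cayley graph $\operatorname{Cay}(G;S)$ has vertex set $G$, with $g$ and $h$ adjacent iff $g = s + h$ for some $s \in S$. A graph $X$ is twin-free if there are no two distinct vertices $v,w$ with $N_X(v) = N_X(w)$, where $N_X(v)$ is the set of neighbours of $v$. The canonical bipartite double cover $BX$ of $X$ has vertex set $V(X) \times \{0,1\}$, with $(v,0)$ adjacent to $(w,1)$ iff $v$ is adjacent to $w$ in $X$ (and no other edges). $S_2$ denotes the symmetric group on $\{0,1\}$, and $\operatorname{Aut} X \times S_2$ is regarded as a subgroup of $\operatorname{Aut}(BX)$ via $(\alpha,\sigma)\cdot(v,i) = (\alpha(v),\sigma(i))$. -}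

module Defs where

open import Level using (0ℓ)
open import Data.Nat using (ℕ)
open import Data.Nat.Divisibility using (_∣_)
open import Data.Fin using (Fin; zero; suc)
open import Data.Product using (Σ; _×_; _,_; ∃)
open import Relation.Nullary using (¬_)
open import Relation.Binary.PropositionalEquality using (_≡_; _≢_)
open import Relation.Binary.Construct.Closure.ReflexiveTransitive using (Star)
open import Function.Bundles using (_↔_; Inverse; _⇔_)
open import Algebra.Core using (Op₁; Op₂)

IsAutomorphism : {V : Set} → (V → V → Set) → V ↔ V → Set
IsAutomorphism {V} Adj f = ∀ (x y : V) → Adj x y ⇔ Adj (Inverse.to f x) (Inverse.to f y)

Connected : {V : Set} → (V → V → Set) → Set
Connected {V} Adj = ∀ (x y : V) → Star Adj x y

TwinFree : {V : Set} → (V → V → Set) → Set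
TwinFree {V} Adj = ∀ (v w : V) → (∀ u → Adj v u ⇔ Adj w u) → v ≡ w

CayAdj : {A : Set} → Op₂ A → (A → Set) → A → A → Set
CayAdj {A} _+_ S g h = Σ A λ s → S s × (g ≡ s + h)

BAdj : {V : Set} → (V → V → Set) → V × Fin 2 → V × Fin 2 → Set
BAdj Adj (v , i) (w , j) = (i ≢ j) × Adj v w

Symmetric : {A : Set} → Op₁ A → (A → Set) → Set
Symmetric -_ S = ∀ s → S s → S (- s)

Odd : ℕ → Set
Odd n = ¬ (2 ∣ n)

module Submission where

open import Defs
open import Data.Nat using (ℕ)
open import Data.Fin using (Fin)
open import Data.Product using (Σ; _×_; _,_)
open import Relation.Binary.PropositionalEquality using (_≡_)
open import Function.Bundles using (_↔_; Inverse)
open import Algebra.Core using (Op₁; Op₂)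
open import Algebra.Structures using (IsAbelianGroup)

open import Data.Nat using (zero; suc; _+_; _*_; _∸_; _≤_; _!; pred)
import Data.Nat.Properties as ℕ
open import Data.Nat.Divisibility
  using (_∣_; divides; ∣-trans; m∣m*n; m≤n⇒m!∣n!; ∣m∣n⇒∣m+n; ∣-refl; _∣0)
open import Data.Nat.GeneralisedArithmetic using (fold; fold-+)
open import Data.Fin using (toℕ; punchIn)
open import Data.Fin.Patterns using (0F; 1F)
import Data.Fin.Properties as Fin
open import Data.Bool.Base using (Bool; true; false; _∧_; _∨_; _xor_)
open import Data.Bool.Properties
  using ( xor-∧-commutativeRing; xor-same; xor-identityʳ; ∧-comm; ∧-idem; ∧-identityʳ; ∧-zeroʳ
        ; ∧-distribˡ-xor; ∧-distribʳ-xor; ∨-identityʳ; not-involutive)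
open import Data.Product using (proj₁; proj₂)
open import Data.Product.Function.NonDependent.Propositional using (_×-↔_; _×-⇔_)
open import Function.Base using (_∘_; const)
open import Function.Bundles using (Injection; mk↔ₛ′; _⇔_; mk⇔; Equivalence)
open import Function.Construct.Composition using (_↔-∘_; _⇔-∘_)
open import Function.Construct.Identity using (↔-id)
open import Function.Construct.Symmetry using (↔-sym; ⇔-sym)
open import Function.Properties.Inverse using (↔⇒↣)
open import Algebra.Bundles using (AbelianGroup; CommutativeRing)
import Algebra.Properties.AbelianGroup as AbelianGroupProperties
import Algebra.Properties.CommutativeSemigroup as CommutativeSemigroupProperties
open import Relation.Binary.Definitions using (DecidableEquality; tri<; tri≈; tri>)
open import Relation.Binary.PropositionalEquality
  using (_≢_; _≗_; refl; sym; trans; cong; cong₂; subst; subst₂; module ≡-Reasoning)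
open import Relation.Binary.Construct.Closure.ReflexiveTransitive using (Star; _◅_)
open import Relation.Nullary using (¬_; Dec; yes; no; does; contradiction)
open import Relation.Nullary.Decidable
  using (via-injection; dec-true; dec-false; does-⇔; _×-dec_; decidable-stable; ¬¬-excluded-middle)

open CommutativeRing xor-∧-commutativeRing using (+-commutativeMonoid)
open import Algebra.Properties.CommutativeMonoid.Sum +-commutativeMonoid
  using (sum; sum-cong-≗; ∑-distrib-+; sum-permute; sum-replicate-zero; sum-remove)

-- Work mod 2 in the group algebra 𝔽₂[A × ℤ/2]. Adjacency in BX is translation invariant,
-- given by the indicator e of S × {1}, and the number of walks of length 2ᵏ from x to y is
-- e^(2ᵏ)(x − y) mod 2. In characteristic 2 squaring only sees the solutions of 2u = d, and
-- doubling is a bijection of A because |A| is odd; hence e^(2ᵏ) (k ≥ 1) vanishes off A × {0},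
-- where it is the indicator of 2ᵏS. For k with 2ᵏ acting trivially on A, "adjacent, or joined
-- by an odd number of walks of length 2ᵏ" relates (a, i) and (b, j) exactly when a − b ∈ S.
-- Every automorphism of BX preserves this relation, in which (v, 0) and (v, 1) are twins; as X
-- is twin-free it maps fibres {v} × ℤ/2 to fibres, and connectedness of X forces it to act on
-- the second coordinate by one permutation σ.

-- Parity of finite sums

sum-true-odd : ∀ m → Odd m → sum {m} (const true) ≡ true
sum-true-odd zero          odd = contradiction (2 ∣0) odd
sum-true-odd (suc zero)    _   = refl
sum-true-odd (suc (suc m)) odd = trans (not-involutive _) (sum-true-odd m (odd ∘ ∣m∣n⇒∣m+n ∣-refl))

sum-indicator : ∀ {m} (j : Fin m) (b : Bool) → sum (λ k → does (k Fin.≟ j) ∧ b) ≡ b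
sum-indicator {suc m} j b = begin
  sum t                        ≡⟨ sum-remove {i = j} t ⟩
  t j xor sum (t ∘ punchIn j)  ≡⟨ cong₂ _xor_ (cong (_∧ b) (dec-true (j Fin.≟ j) refl))
                                              (trans (sum-cong-≗ off-j) (sum-replicate-zero m)) ⟩
  b xor false                  ≡⟨ xor-identityʳ b ⟩
  b                            ∎
  where
  open ≡-Reasoning
  t : Fin (suc m) → Bool
  t k = does (k Fin.≟ j) ∧ b
  off-j : ∀ k → t (punchIn j k) ≡ false
  off-j k = cong (_∧ b) (dec-false (punchIn j k Fin.≟ j) (Fin.punchInᵢ≢i j k))

module FiniteParity {T : Set} {m : ℕ} (enum : T ↔ Fin m) where
  open Inverse enum using (to; from; strictlyInverseˡ; strictlyInverseʳ)

  infix 4 _≟_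
  _≟_ : DecidableEquality T
  _≟_ = via-injection (↔⇒↣ enum) Fin._≟_

  parity : (T → Bool) → Bool
  parity f = sum (f ∘ from)

  parity-cong : {f g : T → Bool} → f ≗ g → parity f ≡ parity g
  parity-cong f≗g = sum-cong-≗ (f≗g ∘ from)

  parity-xor : (f g : T → Bool) → parity (λ x → f x xor g x) ≡ parity f xor parity g
  parity-xor f g = ∑-distrib-+ (f ∘ from) (g ∘ from)

  parity-false : parity (const false) ≡ false
  parity-false = sum-replicate-zero m

  parity-true : Odd m → parity (const true) ≡ true
  parity-true = sum-true-odd m

  parity-permute : (f : T → Bool) (π : T ↔ T) → parity (f ∘ Inverse.to π) ≡ parity f
  parity-permute f π = sym (begin
    sum (f ∘ from)
      ≡⟨ sum-permute (f ∘ from) (enum ↔-∘ (π ↔-∘ ↔-sym enum)) ⟩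
    sum (λ k → f (from (to (πᵗ (from k)))))
      ≡⟨ sum-cong-≗ (λ k → cong f (strictlyInverseʳ (πᵗ (from k)))) ⟩
    parity (f ∘ πᵗ)
      ∎)
    where
    open ≡-Reasoning
    πᵗ = Inverse.to π

  parity-singleton : (p : T) (f : T → Bool) → parity (λ x → does (x ≟ p) ∧ f x) ≡ f p
  parity-singleton p f = trans (sum-cong-≗ at-p) (sum-indicator (to p) (f p))
    where
    only-p : ∀ x → does (x ≟ p) ∧ f x ≡ does (x ≟ p) ∧ f p
    only-p x with x ≟ p
    ... | yes x≡p = cong (λ y → does (x ≟ p) ∧ f y) x≡p
    ... | no  x≢p = trans (cong (_∧ f x) (dec-false (x ≟ p) x≢p))
                          (sym (cong (_∧ f p) (dec-false (x ≟ p) x≢p)))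
    at-p : ∀ k → does (from k ≟ p) ∧ f (from k) ≡ does (k Fin.≟ to p) ∧ f p
    at-p k = trans (only-p (from k)) (cong (λ i → does (i Fin.≟ to p) ∧ f p) (strictlyInverseˡ k))

  infixl 7 _⊙_
  _⊙_ : (T → T → Bool) → (T → T → Bool) → T → T → Bool
  (R ⊙ R′) x y = parity (λ z → R x z ∧ R′ z y)

  ⊙-invariant : (π : T ↔ T) {R R′ : T → T → Bool} →
                (∀ x y → R (Inverse.to π x) (Inverse.to π y) ≡ R x y) →
                (∀ x y → R′ (Inverse.to π x) (Inverse.to π y) ≡ R′ x y) →
                ∀ x y → (R ⊙ R′) (Inverse.to π x) (Inverse.to π y) ≡ (R ⊙ R′) x y
  ⊙-invariant π {R} {R′} R-inv R′-inv x y = begin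
    parity (λ z → R (πᵗ x) z ∧ R′ z (πᵗ y))
      ≡⟨ parity-permute (λ z → R (πᵗ x) z ∧ R′ z (πᵗ y)) π ⟨
    parity (λ z → R (πᵗ x) (πᵗ z) ∧ R′ (πᵗ z) (πᵗ y))
      ≡⟨ parity-cong (λ z → cong₂ _∧_ (R-inv x z) (R′-inv z y)) ⟩
    parity (λ z → R x z ∧ R′ z y)
      ∎
    where
    open ≡-Reasoning
    πᵗ = Inverse.to π

  module _ (ι : T → T) (ι-involutive : ∀ x → ι (ι x) ≡ x) where

    -- Off the fixed points, `below` picks exactly one point of each pair {x, ι x}.
    private
      below : T → Bool
      below x = does (to x Fin.<? to (ι x))

      below-ι : ∀ x → below (ι x) ≡ does (to (ι x) Fin.<? to x)
      below-ι x = cong (λ y → does (to (ι x) Fin.<? to y)) (ι-involutive x)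

      trichotomy : ∀ x → does (ι x ≟ x) xor (below x xor does (to (ι x) Fin.<? to x)) ≡ true
      trichotomy x with Fin.<-cmp (to x) (to (ι x))
      ... | tri< x<ιx x≢ιx ιx≮x
        rewrite dec-false (ι x ≟ x) (x≢ιx ∘ cong to ∘ sym)
              | dec-true (to x Fin.<? to (ι x)) x<ιx
              | dec-false (to (ι x) Fin.<? to x) ιx≮x = refl
      ... | tri≈ x≮ιx x≡ιx ιx≮x
        rewrite dec-true (ι x ≟ x) (Injection.injective (↔⇒↣ enum) (sym x≡ιx))
              | dec-false (to x Fin.<? to (ι x)) x≮ιx
              | dec-false (to (ι x) Fin.<? to x) ιx≮x = refl
      ... | tri> x≮ιx x≢ιx ιx<x
        rewrite dec-false (ι x ≟ x) (x≢ιx ∘ cong to ∘ sym)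
              | dec-false (to x Fin.<? to (ι x)) x≮ιx
              | dec-true (to (ι x) Fin.<? to x) ιx<x = refl

      exactly-one : ∀ x → does (ι x ≟ x) xor (below x xor below (ι x)) ≡ true
      exactly-one x = trans (cong (λ c → does (ι x ≟ x) xor (below x xor c)) (below-ι x)) (trichotomy x)

    parity-involution : (f : T → Bool) → f ∘ ι ≗ f → parity f ≡ parity (λ x → f x ∧ does (ι x ≟ x))
    parity-involution f f∘ι≗f = begin
      parity f
        ≡⟨ parity-cong split ⟩
      parity (λ x → onFixed x xor (onBelow x xor onAbove x))
        ≡⟨ parity-xor onFixed (λ x → onBelow x xor onAbove x) ⟩
      parity onFixed xor parity (λ x → onBelow x xor onAbove x)
        ≡⟨ cong (parity onFixed xor_) (parity-xor onBelow onAbove) ⟩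
      parity onFixed xor (parity onBelow xor parity onAbove)
        ≡⟨ cong (λ z → parity onFixed xor (parity onBelow xor z)) paired ⟩
      parity onFixed xor (parity onBelow xor parity onBelow)
        ≡⟨ cong (parity onFixed xor_) (xor-same (parity onBelow)) ⟩
      parity onFixed xor false
        ≡⟨ xor-identityʳ (parity onFixed) ⟩
      parity onFixed
        ∎
      where
      open ≡-Reasoning
      onFixed onBelow onAbove : T → Bool
      onFixed x = f x ∧ does (ι x ≟ x)
      onBelow x = f x ∧ below x
      onAbove x = f x ∧ below (ι x)

      split : ∀ x → f x ≡ onFixed x xor (onBelow x xor onAbove x)
      split x = begin
        f x                                                   ≡⟨ ∧-identityʳ (f x) ⟨
        f x ∧ true                                            ≡⟨ cong (f x ∧_) (exactly-one x) ⟨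
        f x ∧ (does (ι x ≟ x) xor (below x xor below (ι x)))  ≡⟨ ∧-distribˡ-xor (f x) _ _ ⟩
        onFixed x xor (f x ∧ (below x xor below (ι x)))       ≡⟨ cong (onFixed x xor_)
                                                                      (∧-distribˡ-xor (f x) _ _) ⟩
        onFixed x xor (onBelow x xor onAbove x)               ∎

      paired : parity onAbove ≡ parity onBelow
      paired = trans (parity-cong (λ x → cong (_∧ below (ι x)) (sym (f∘ι≗f x))))
                     (parity-permute onBelow (mk↔ₛ′ ι ι ι-involutive ι-involutive))

    involution-has-fixedPoint : Odd m → ¬ (∀ x → ι x ≢ x)
    involution-has-fixedPoint odd no-fixedPoint = contradiction true≡false λ ()
      where
      open ≡-Reasoning
      true≡false : true ≡ false
      true≡false = begin
        true                           ≡⟨ parity-true odd ⟨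
        parity (const true)            ≡⟨ parity-involution (const true) (λ _ → refl) ⟩
        parity (λ x → does (ι x ≟ x))  ≡⟨ parity-cong (λ x → dec-false (ι x ≟ x) (no-fixedPoint x)) ⟩
        parity (const false)           ≡⟨ parity-false ⟩
        false                          ∎

-- Finite sets: decidability and periodicity

does-≡⇒⇔ : {P Q : Set} (P? : Dec P) (Q? : Dec Q) → does P? ≡ does Q? → P ⇔ Q
does-≡⇒⇔ (yes p) (yes q) _ = mk⇔ (λ _ → q) (λ _ → p)
does-≡⇒⇔ (no ¬p) (no ¬q) _ = mk⇔ (λ p → contradiction p ¬p) (λ q → contradiction q ¬q)
does-≡⇒⇔ (yes _) (no _)  ()
does-≡⇒⇔ (no _)  (yes _) ()

¬¬-decidable-Fin : ∀ m (P : Fin m → Set) → ¬ ¬ (∀ k → Dec (P k))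
¬¬-decidable-Fin zero    P ¬dec = ¬dec λ ()
¬¬-decidable-Fin (suc m) P ¬dec = ¬¬-excluded-middle λ P0? →
  ¬¬-decidable-Fin m (P ∘ Fin.suc) λ P∘suc? → ¬dec λ { 0F → P0? ; (Fin.suc k) → P∘suc? k }

m∣m! : ∀ {m} → 1 ≤ m → m ∣ m !
m∣m! {suc m} _ = m∣m*n (m !)

module _ {T : Set} {n : ℕ} (enum : T ↔ Fin n) where
  open Inverse enum using (to; from; strictlyInverseʳ)

  ¬¬-decidable : (P : T → Set) → ¬ ¬ (∀ x → Dec (P x))
  ¬¬-decidable P ¬dec = ¬¬-decidable-Fin n (P ∘ from) λ P∘from? →
    ¬dec λ x → subst (Dec ∘ P) (strictlyInverseʳ x) (P∘from? (to x))

  module _ {f : T → T} (f-injective : ∀ {x y} → f x ≡ f y → x ≡ y) where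

    fold-injective : ∀ k {x y} → fold x f k ≡ fold y f k → x ≡ y
    fold-injective zero    eq = eq
    fold-injective (suc k) eq = fold-injective k (f-injective eq)

    fold-multiple : ∀ {x} p → fold x f p ≡ x → ∀ q → fold x f (q * p) ≡ x
    fold-multiple         p returns zero    = refl
    fold-multiple {x = x} p returns (suc q) = begin
      fold x f (p + q * p)         ≡⟨ fold-+ x f p ⟩
      fold (fold x f (q * p)) f p  ≡⟨ cong (λ y → fold y f p) (fold-multiple p returns q) ⟩
      fold x f p                   ≡⟨ returns ⟩
      x                            ∎
      where open ≡-Reasoning

    orbit-returns : ∀ x → Σ ℕ λ p → 1 ≤ p × p ≤ n × fold x f p ≡ x
    orbit-returns x with Fin.pigeonhole (ℕ.n<1+n n) (λ k → to (fold x f (toℕ k)))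
    ... | i , j , i<j , same-code =
      toℕ j ∸ toℕ i , ℕ.m<n⇒0<n∸m i<j , p≤n , fold-injective (toℕ i) returns
      where
      open ≡-Reasoning
      p≤n : toℕ j ∸ toℕ i ≤ n
      p≤n = ℕ.≤-trans (ℕ.m∸n≤m (toℕ j) (toℕ i)) (ℕ.≤-pred (Fin.toℕ<n j))
      returns : fold (fold x f (toℕ j ∸ toℕ i)) f (toℕ i) ≡ fold x f (toℕ i)
      returns = begin
        fold (fold x f (toℕ j ∸ toℕ i)) f (toℕ i)  ≡⟨ fold-+ x f (toℕ i) ⟨
        fold x f (toℕ i + (toℕ j ∸ toℕ i))         ≡⟨ cong (fold x f) (ℕ.m+[n∸m]≡n (ℕ.<⇒≤ i<j)) ⟩
        fold x f (toℕ j)                           ≡⟨ Injection.injective (↔⇒↣ enum) same-code ⟨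
        fold x f (toℕ i)                           ∎

    fold-factorial : ∀ x → fold x f (n !) ≡ x
    fold-factorial x with orbit-returns x
    ... | p , 1≤p , p≤n , returns with divides q n!≡q*p ← ∣-trans (m∣m! 1≤p) (m≤n⇒m!∣n! p≤n) =
      subst (λ k → fold x f k ≡ x) (sym n!≡q*p) (fold-multiple p returns q)

    injective-periodic : Σ ℕ λ k → ∀ x → fold x f (suc k) ≡ x
    injective-periodic = pred (n !) , λ x →
      subst (λ k → fold x f k ≡ x) (sym (ℕ.suc-pred (n !) {{ℕ._!≢0 n}})) (fold-factorial x)

infixl 6 _⊕₂_
_⊕₂_ : Fin 2 → Fin 2 → Fin 2
0F ⊕₂ j  = j
1F ⊕₂ 0F = 1F
1F ⊕₂ 1F = 0F

⊕₂-cancelˡ : ∀ i j → i ⊕₂ (i ⊕₂ j) ≡ j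
⊕₂-cancelˡ 0F j  = refl
⊕₂-cancelˡ 1F 0F = refl
⊕₂-cancelˡ 1F 1F = refl

⊕₂-cancelʳ : ∀ i j → i ⊕₂ j ⊕₂ j ≡ i
⊕₂-cancelʳ 0F 0F = refl
⊕₂-cancelʳ 0F 1F = refl
⊕₂-cancelʳ 1F 0F = refl
⊕₂-cancelʳ 1F 1F = refl

⊕₂-swapʳ : ∀ i j k → i ⊕₂ j ⊕₂ k ≡ i ⊕₂ k ⊕₂ j
⊕₂-swapʳ 0F 0F 0F = refl
⊕₂-swapʳ 0F 0F 1F = refl
⊕₂-swapʳ 0F 1F 0F = refl
⊕₂-swapʳ 0F 1F 1F = refl
⊕₂-swapʳ 1F 0F 0F = refl
⊕₂-swapʳ 1F 0F 1F = refl
⊕₂-swapʳ 1F 1F 0F = refl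
⊕₂-swapʳ 1F 1F 1F = refl

⊕₂≡1⇔≢ : ∀ i j → i ⊕₂ j ≡ 1F ⇔ i ≢ j
⊕₂≡1⇔≢ 0F 0F = mk⇔ (λ ()) (λ i≢j → contradiction refl i≢j)
⊕₂≡1⇔≢ 0F 1F = mk⇔ (λ _ ()) (λ _ → refl)
⊕₂≡1⇔≢ 1F 0F = mk⇔ (λ _ ()) (λ _ → refl)
⊕₂≡1⇔≢ 1F 1F = mk⇔ (λ ()) (λ i≢j → contradiction refl i≢j)

≢⇒≡1⊕₂ : ∀ {i j} → i ≢ j → j ≡ 1F ⊕₂ i
≢⇒≡1⊕₂ {0F} {0F} i≢j = contradiction refl i≢j
≢⇒≡1⊕₂ {0F} {1F} _   = refl
≢⇒≡1⊕₂ {1F} {0F} _   = refl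
≢⇒≡1⊕₂ {1F} {1F} i≢j = contradiction refl i≢j

≢1⊕₂⇒≡ : ∀ {i j} → i ≢ 1F ⊕₂ j → i ≡ j
≢1⊕₂⇒≡ {0F} {0F} _   = refl
≢1⊕₂⇒≡ {0F} {1F} i≢k = contradiction refl i≢k
≢1⊕₂⇒≡ {1F} {0F} i≢k = contradiction refl i≢k
≢1⊕₂⇒≡ {1F} {1F} _   = refl

1⊕₂i≢i : ∀ i → 1F ⊕₂ i ≢ i
1⊕₂i≢i 0F ()
1⊕₂i≢i 1F ()

-- Bipartite double covers

FibrePreserving : {V : Set} → (V × Fin 2) ↔ (V × Fin 2) → Set
FibrePreserving {V} φ = ∀ (v : V) → proj₁ (Inverse.to φ (v , 0F)) ≡ proj₁ (Inverse.to φ (v , 1F))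

module DoubleCover {V : Set} (Adj : V → V → Set) where

  product-isAutomorphism : {α : V ↔ V} → IsAutomorphism Adj α → (σ : Fin 2 ↔ Fin 2) →
                           IsAutomorphism (BAdj Adj) (α ×-↔ σ)
  product-isAutomorphism α-aut σ (v , i) (w , j) = mk⇔
    (λ (i≢j , v~w) → i≢j ∘ Injection.injective (↔⇒↣ σ) , Equivalence.to (α-aut v w) v~w)
    (λ (σi≢σj , αv~αw) → σi≢σj ∘ cong (Inverse.to σ) , Equivalence.from (α-aut v w) αv~αw)

  product-isAutomorphism⁻¹ : {φ : (V × Fin 2) ↔ (V × Fin 2)} → IsAutomorphism (BAdj Adj) φ →
                             (α : V ↔ V) (σ : Fin 2 ↔ Fin 2) →
                             (∀ v i → Inverse.to φ (v , i) ≡ (Inverse.to α v , Inverse.to σ i)) →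
                             IsAutomorphism Adj α
  product-isAutomorphism⁻¹ φ-aut α σ product-form v w = mk⇔
    (λ v~w → proj₂ (subst₂ (BAdj Adj) (product-form v 0F) (product-form w 1F)
                      (Equivalence.to (φ-aut (v , 0F) (w , 1F)) ((λ ()) , v~w))))
    (λ αv~αw → proj₂ (Equivalence.from (φ-aut (v , 0F) (w , 1F))
                        (subst₂ (BAdj Adj) (sym (product-form v 0F)) (sym (product-form w 1F))
                          ((λ ()) ∘ Injection.injective (↔⇒↣ σ) , αv~αw))))

  module _ (connected : Connected Adj) (v₀ : V)
           (φ : (V × Fin 2) ↔ (V × Fin 2)) (φ-aut : IsAutomorphism (BAdj Adj) φ)
           (φ-fibres : FibrePreserving φ) where
    open Inverse φ using (to; from; strictlyInverseˡ; strictlyInverseʳ)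

    private
      side : V → Fin 2
      side v = proj₂ (to (v , 0F))

      side-1F : ∀ v → proj₂ (to (v , 1F)) ≡ 1F ⊕₂ side v
      side-1F v = ≢⇒≡1⊕₂ {side v} λ same →
        Fin.0≢1+n (cong proj₂ (Injection.injective (↔⇒↣ φ) (cong₂ _,_ (φ-fibres v) same)))

      side-adjacent : ∀ {v w} → Adj v w → side v ≡ side w
      side-adjacent {v} {w} v~w = ≢1⊕₂⇒≡ λ same →
        proj₁ (Equivalence.to (φ-aut (v , 0F) (w , 1F)) ((λ ()) , v~w)) (trans same (sym (side-1F w)))

      side-connected : ∀ {v w} → Star Adj v w → side v ≡ side w
      side-connected Star.ε      = refl
      side-connected (v~u ◅ u⇝w) = trans (side-adjacent v~u) (side-connected u⇝w)

      s₀ : Fin 2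
      s₀ = side v₀

      product-form : ∀ v i → to (v , i) ≡ (proj₁ (to (v , 0F)) , i ⊕₂ s₀)
      product-form v 0F = cong (proj₁ (to (v , 0F)) ,_) (side-connected (connected v v₀))
      product-form v 1F = cong₂ _,_ (sym (φ-fibres v))
                                    (trans (side-1F v) (cong (1F ⊕₂_) (side-connected (connected v v₀))))

      α : V ↔ V
      α = mk↔ₛ′ (λ v → proj₁ (to (v , 0F))) (λ a → proj₁ (from (a , s₀))) α∘α⁻¹ α⁻¹∘α
        where
        α∘α⁻¹ : ∀ a → proj₁ (to (proj₁ (from (a , s₀)) , 0F)) ≡ a
        α∘α⁻¹ a = cong proj₁ (trans (sym (product-form _ _)) (strictlyInverseˡ (a , s₀)))
        α⁻¹∘α : ∀ v → proj₁ (from (proj₁ (to (v , 0F)) , s₀)) ≡ v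
        α⁻¹∘α v = cong proj₁ (trans (cong from (sym (product-form v 0F))) (strictlyInverseʳ (v , 0F)))

      σ : Fin 2 ↔ Fin 2
      σ = mk↔ₛ′ (_⊕₂ s₀) (_⊕₂ s₀) (λ i → ⊕₂-cancelʳ i s₀) (λ i → ⊕₂-cancelʳ i s₀)

    fibrePreserving⇒product : Σ (V ↔ V) λ α → IsAutomorphism Adj α × Σ (Fin 2 ↔ Fin 2) λ σ →
                                ∀ v i → to (v , i) ≡ (Inverse.to α v , Inverse.to σ i)
    fibrePreserving⇒product = α , product-isAutomorphism⁻¹ {φ} φ-aut α σ product-form , σ , product-form

-- Cayley graphs on abelian groups of odd order

module OddAbelian {A : Set} {_+_ : Op₂ A} {0# : A} { -_ : Op₁ A}
                  (isAbelianGroup : IsAbelianGroup _≡_ _+_ 0# -_)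
                  {n : ℕ} (enum : A ↔ Fin n) (odd : Odd n) where
  private
    G : AbelianGroup _ _
    G = record { isAbelianGroup = isAbelianGroup }
  open AbelianGroup G
    using (_∙_; ε; _⁻¹; _-_; assoc; comm; identityʳ; inverseˡ; inverseʳ; commutativeSemigroup)
  open AbelianGroupProperties G
    using ( //-rightDividesˡ; //-rightDividesʳ; \\-leftDividesʳ
          ; ⁻¹-anti-homo‿-; ⁻¹-∙-comm; x∙y⁻¹≈ε⇒x≈y)
  open CommutativeSemigroupProperties commutativeSemigroup using (interchange)
  module ParityA = FiniteParity enum

  x-[x-y]≡y : ∀ x y → x - (x - y) ≡ y
  x-[x-y]≡y x y = begin
    x ∙ (x - y) ⁻¹  ≡⟨ cong (x ∙_) (⁻¹-anti-homo‿- x y) ⟩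
    x ∙ (y - x)     ≡⟨ comm x (y - x) ⟩
    (y - x) ∙ x     ≡⟨ //-rightDividesˡ x y ⟩
    y               ∎
    where open ≡-Reasoning

  [x-y]-z≡[x-z]-y : ∀ x y z → x - y - z ≡ x - z - y
  [x-y]-z≡[x-z]-y x y z = begin
    x - y - z          ≡⟨ assoc x (y ⁻¹) (z ⁻¹) ⟩
    x ∙ (y ⁻¹ ∙ z ⁻¹)  ≡⟨ cong (x ∙_) (comm (y ⁻¹) (z ⁻¹)) ⟩
    x ∙ (z ⁻¹ ∙ y ⁻¹)  ≡⟨ assoc x (z ⁻¹) (y ⁻¹) ⟨
    x - z - y          ∎
    where open ≡-Reasoning

  CayAdj⇔S : ∀ {S : A → Set} v w → CayAdj _∙_ S v w ⇔ S (v - w)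
  CayAdj⇔S {S} v w = mk⇔
    (λ (s , Ss , v≡s∙w) → subst S (sym (trans (cong (_- w) v≡s∙w) (//-rightDividesʳ w s))) Ss)
    (λ Sv-w → v - w , Sv-w , sym (//-rightDividesˡ w v))

  double : A → A
  double a = a ∙ a

  -- If a ≢ b then x ↦ x ∙ (a - b) is a fixed-point-free involution of a set of odd size.
  double-injective : ∀ {a b} → double a ≡ double b → a ≡ b
  double-injective {a} {b} 2a≡2b with a - b ParityA.≟ ε
  ... | yes a-b≡ε = x∙y⁻¹≈ε⇒x≈y a b a-b≡ε
  ... | no  a-b≢ε = contradiction shift-fixedPointFree
                      (ParityA.involution-has-fixedPoint (_∙ (a - b)) shift-involutive odd)
    where
    open ≡-Reasoning
    2[a-b]≡ε : (a - b) ∙ (a - b) ≡ ε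
    2[a-b]≡ε = begin
      (a - b) ∙ (a - b)        ≡⟨ interchange a (b ⁻¹) a (b ⁻¹) ⟩
      (a ∙ a) ∙ (b ⁻¹ ∙ b ⁻¹)  ≡⟨ cong₂ _∙_ 2a≡2b (⁻¹-∙-comm b b) ⟩
      (b ∙ b) ∙ (b ∙ b) ⁻¹     ≡⟨ inverseʳ (b ∙ b) ⟩
      ε                        ∎
    shift-involutive : ∀ x → x ∙ (a - b) ∙ (a - b) ≡ x
    shift-involutive x = trans (assoc x (a - b) (a - b)) (trans (cong (x ∙_) 2[a-b]≡ε) (identityʳ x))
    shift-fixedPointFree : ∀ x → x ∙ (a - b) ≢ x
    shift-fixedPointFree x x∙[a-b]≡x = a-b≢ε (begin
      a - b                 ≡⟨ \\-leftDividesʳ x (a - b) ⟨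
      x ⁻¹ ∙ (x ∙ (a - b))  ≡⟨ cong (x ⁻¹ ∙_) x∙[a-b]≡x ⟩
      x ⁻¹ ∙ x              ≡⟨ inverseˡ x ⟩
      ε                     ∎)

  doubling-period : Σ ℕ λ k → ∀ g → fold g double (suc k) ≡ g
  doubling-period = injective-periodic enum double-injective

  V : Set
  V = A × Fin 2

  infixl 6 _⊟_
  _⊟_ : V → V → V
  (a , i) ⊟ (b , j) = (a - b , i ⊕₂ j)

  ⊟-cancelˡ : ∀ x y → x ⊟ (x ⊟ y) ≡ y
  ⊟-cancelˡ (a , i) (b , j) = cong₂ _,_ (x-[x-y]≡y a b) (⊕₂-cancelˡ i j)

  ⊟-swapʳ : ∀ x y z → x ⊟ y ⊟ z ≡ x ⊟ z ⊟ y
  ⊟-swapʳ (a , i) (b , j) (c , k) = cong₂ _,_ ([x-y]-z≡[x-z]-y a b c) (⊕₂-swapʳ i j k)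

  V-enum : V ↔ Fin (n * 2)
  V-enum = ↔-sym Fin.*↔× ↔-∘ (enum ×-↔ ↔-id (Fin 2))

  open FiniteParity V-enum

  -- The square of r in the group algebra 𝔽₂[A × ℤ/2].
  convolve : (V → Bool) → V → Bool
  convolve r d = parity (λ u → r u ∧ r (d ⊟ u))

  ⊙-convolve : ∀ r x y → ((λ x y → r (x ⊟ y)) ⊙ (λ x y → r (x ⊟ y))) x y ≡ convolve r (x ⊟ y)
  ⊙-convolve r x y = begin
    parity (λ z → r (x ⊟ z) ∧ r (z ⊟ y))
      ≡⟨ parity-permute (λ z → r (x ⊟ z) ∧ r (z ⊟ y)) reflect ⟨
    parity (λ u → r (x ⊟ (x ⊟ u)) ∧ r (x ⊟ u ⊟ y))
      ≡⟨ parity-cong (λ u → cong₂ _∧_ (cong r (⊟-cancelˡ x u)) (cong r (⊟-swapʳ x u y))) ⟩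
    parity (λ u → r u ∧ r (x ⊟ y ⊟ u))
      ∎
    where
    open ≡-Reasoning
    reflect : V ↔ V
    reflect = mk↔ₛ′ (x ⊟_) (x ⊟_) (⊟-cancelˡ x) (⊟-cancelˡ x)

  -- Frobenius: the terms for u and d ⊟ u cancel, leaving the u with d ⊟ u = u, i.e. 2u = d.
  convolve-fixedPoints : ∀ r d → convolve r d ≡ parity (λ u → does (d ⊟ u ≟ u) ∧ r u)
  convolve-fixedPoints r d = trans
    (parity-involution (d ⊟_) (⊟-cancelˡ d) (λ u → r u ∧ r (d ⊟ u))
      (λ u → trans (cong (r (d ⊟ u) ∧_) (cong r (⊟-cancelˡ d u))) (∧-comm (r (d ⊟ u)) (r u))))
    (parity-cong on-fixedPoints)
    where
    open ≡-Reasoning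
    on-fixedPoints : ∀ u → (r u ∧ r (d ⊟ u)) ∧ does (d ⊟ u ≟ u) ≡ does (d ⊟ u ≟ u) ∧ r u
    on-fixedPoints u with d ⊟ u ≟ u
    ... | yes fixed = begin
      (r u ∧ r (d ⊟ u)) ∧ does (d ⊟ u ≟ u)  ≡⟨ cong₂ (λ v b → (r u ∧ r v) ∧ b) fixed
                                                      (dec-true (d ⊟ u ≟ u) fixed) ⟩
      (r u ∧ r u) ∧ true                    ≡⟨ trans (∧-identityʳ _) (∧-idem (r u)) ⟩
      r u                                   ≡⟨ cong (_∧ r u) (dec-true (d ⊟ u ≟ u) fixed) ⟨
      does (d ⊟ u ≟ u) ∧ r u                ∎
    ... | no unfixed = begin
      (r u ∧ r (d ⊟ u)) ∧ does (d ⊟ u ≟ u)  ≡⟨ cong ((r u ∧ r (d ⊟ u)) ∧_)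
                                                     (dec-false (d ⊟ u ≟ u) unfixed) ⟩
      (r u ∧ r (d ⊟ u)) ∧ false             ≡⟨ ∧-zeroʳ _ ⟩
      false                                 ≡⟨ cong (_∧ r u) (dec-false (d ⊟ u ≟ u) unfixed) ⟨
      does (d ⊟ u ≟ u) ∧ r u                ∎

  convolve-odd : ∀ r g → convolve r (g , 1F) ≡ false
  convolve-odd r g = trans (convolve-fixedPoints r (g , 1F)) (trans (parity-cong no-fixedPoint) parity-false)
    where
    no-fixedPoint : ∀ u → does ((g , 1F) ⊟ u ≟ u) ∧ r u ≡ false
    no-fixedPoint u = cong (_∧ r u) (dec-false ((g , 1F) ⊟ u ≟ u) (1⊕₂i≢i _ ∘ cong proj₂))

  fixedPoints-even : ∀ h u → does ((h ∙ h , 0F) ⊟ u ≟ u) ≡ does (u ≟ (h , 0F)) xor does (u ≟ (h , 1F))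
  fixedPoints-even h (a , j) with a ParityA.≟ h
  ... | no a≢h =
    trans (dec-false ((h ∙ h , 0F) ⊟ (a , j) ≟ (a , j)) (a≢h ∘ halve))
          (sym (cong₂ _xor_ (dec-false ((a , j) ≟ (h , 0F)) (a≢h ∘ cong proj₁))
                            (dec-false ((a , j) ≟ (h , 1F)) (a≢h ∘ cong proj₁))))
    where
    open ≡-Reasoning
    halve : (h ∙ h , 0F) ⊟ (a , j) ≡ (a , j) → a ≡ h
    halve fixed = double-injective (begin
      a ∙ a            ≡⟨ cong (_∙ a) (cong proj₁ fixed) ⟨
      (h ∙ h - a) ∙ a  ≡⟨ //-rightDividesˡ a (h ∙ h) ⟩
      h ∙ h            ∎)
  ... | yes refl with j
  ...   | 0F = trans (dec-true ((a ∙ a , 0F) ⊟ (a , 0F) ≟ (a , 0F)) (cong (_, 0F) (//-rightDividesʳ a a)))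
                     (sym (cong₂ _xor_ (dec-true ((a , 0F) ≟ (a , 0F)) refl)
                                       (dec-false ((a , 0F) ≟ (a , 1F)) λ ())))
  ...   | 1F = trans (dec-true ((a ∙ a , 0F) ⊟ (a , 1F) ≟ (a , 1F)) (cong (_, 1F) (//-rightDividesʳ a a)))
                     (sym (cong₂ _xor_ (dec-false ((a , 1F) ≟ (a , 0F)) λ ())
                                       (dec-true ((a , 1F) ≟ (a , 1F)) refl)))

  convolve-even : ∀ r h → convolve r (h ∙ h , 0F) ≡ r (h , 0F) xor r (h , 1F)
  convolve-even r h = begin
    convolve r (h ∙ h , 0F)                                   ≡⟨ convolve-fixedPoints r (h ∙ h , 0F) ⟩
    parity (λ u → does ((h ∙ h , 0F) ⊟ u ≟ u) ∧ r u)          ≡⟨ parity-cong split ⟩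
    parity (λ u → at (h , 0F) u xor at (h , 1F) u)            ≡⟨ parity-xor (at (h , 0F)) (at (h , 1F)) ⟩
    parity (at (h , 0F)) xor parity (at (h , 1F))             ≡⟨ cong₂ _xor_ (parity-singleton (h , 0F) r)
                                                                             (parity-singleton (h , 1F) r) ⟩
    r (h , 0F) xor r (h , 1F)                                 ∎
    where
    open ≡-Reasoning
    at : V → V → Bool
    at p u = does (u ≟ p) ∧ r u
    split : ∀ u → does ((h ∙ h , 0F) ⊟ u ≟ u) ∧ r u ≡ at (h , 0F) u xor at (h , 1F) u
    split u = trans (cong (_∧ r u) (fixedPoints-even h u))
                    (∧-distribʳ-xor (r u) (does (u ≟ (h , 0F))) (does (u ≟ (h , 1F))))

  module Walks {S : A → Set} (S? : ∀ a → Dec (S a)) where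
    private
      X = CayAdj _∙_ S

    Edge : V → Set
    Edge (a , i) = i ≡ 1F × S a

    Edge? : ∀ d → Dec (Edge d)
    Edge? (a , i) = (i Fin.≟ 1F) ×-dec S? a

    Edge⇔BAdj : ∀ x y → Edge (x ⊟ y) ⇔ BAdj X x y
    Edge⇔BAdj (a , i) (b , j) = ⊕₂≡1⇔≢ i j ×-⇔ ⇔-sym (CayAdj⇔S a b)

    edge : V → Bool
    edge d = does (Edge? d)

    -- walks k (x ⊟ y) is the parity of the number of walks of length 2ᵏ from x to y in BX.
    walks : ℕ → V → Bool
    walks zero    = edge
    walks (suc k) = convolve (walks k)

    module _ {φ : V ↔ V} (φ-aut : IsAutomorphism (BAdj X) φ) where
      open Inverse φ using (to)

      edge-invariant : ∀ x y → edge (to x ⊟ to y) ≡ edge (x ⊟ y)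
      edge-invariant x y =
        does-⇔ (⇔-sym (Edge⇔BAdj x y) ⇔-∘ (⇔-sym (φ-aut x y) ⇔-∘ Edge⇔BAdj (to x) (to y)))
               (Edge? (to x ⊟ to y)) (Edge? (x ⊟ y))

      walks-invariant : ∀ k x y → walks k (to x ⊟ to y) ≡ walks k (x ⊟ y)
      walks-invariant zero    = edge-invariant
      walks-invariant (suc k) x y = begin
        convolve (walks k) (to x ⊟ to y)  ≡⟨ ⊙-convolve (walks k) (to x) (to y) ⟨
        (W ⊙ W) (to x) (to y)             ≡⟨ ⊙-invariant φ (walks-invariant k) (walks-invariant k) x y ⟩
        (W ⊙ W) x y                       ≡⟨ ⊙-convolve (walks k) x y ⟩
        convolve (walks k) (x ⊟ y)        ∎
        where
        open ≡-Reasoning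
        W : V → V → Bool
        W x y = walks k (x ⊟ y)

    walks-odd : ∀ k g → walks (suc k) (g , 1F) ≡ false
    walks-odd k = convolve-odd (walks k)

    walks-even : ∀ k g → walks (suc k) (fold g double (suc k) , 0F) ≡ does (S? g)
    walks-even zero    g = convolve-even edge g
    walks-even (suc k) g = begin
      walks (suc (suc k)) (double h , 0F)                ≡⟨ convolve-even (walks (suc k)) h ⟩
      walks (suc k) (h , 0F) xor walks (suc k) (h , 1F)  ≡⟨ cong₂ _xor_ (walks-even k g) (walks-odd k h) ⟩
      does (S? g) xor false                              ≡⟨ xor-identityʳ _ ⟩
      does (S? g)                                        ∎
      where
      open ≡-Reasoning
      h = fold g double (suc k)

    private
      K : ℕ
      K = proj₁ doubling-period

    reach : V → Bool
    reach d = edge d ∨ walks (suc K) d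

    reach-fibre : ∀ d → reach d ≡ does (S? (proj₁ d))
    reach-fibre (c , 0F) = trans (cong (λ g → walks (suc K) (g , 0F)) (sym (proj₂ doubling-period c)))
                                 (walks-even K c)
    reach-fibre (c , 1F) = trans (cong (does (S? c) ∨_) (walks-odd K c)) (∨-identityʳ _)

    reach-invariant : ∀ {φ} → IsAutomorphism (BAdj X) φ →
                      ∀ x y → reach (Inverse.to φ x ⊟ Inverse.to φ y) ≡ reach (x ⊟ y)
    reach-invariant {φ} φ-aut x y =
      cong₂ _∨_ (edge-invariant {φ} φ-aut x y) (walks-invariant {φ} φ-aut (suc K) x y)

    isAutomorphism⇒fibrePreserving : TwinFree X → ∀ {φ} → IsAutomorphism (BAdj X) φ → FibrePreserving φ
    isAutomorphism⇒fibrePreserving twinFree {φ} φ-aut v = twinFree a b λ u →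
      ⇔-sym (CayAdj⇔S b u)
        ⇔-∘ (does-≡⇒⇔ (S? (a - u)) (S? (b - u)) (same-neighbours u) ⇔-∘ CayAdj⇔S a u)
      where
      open Inverse φ using (to; from; strictlyInverseˡ)
      open ≡-Reasoning
      a = proj₁ (to (v , 0F))
      b = proj₁ (to (v , 1F))

      reach-pullback : ∀ i u → reach (to (v , i) ⊟ (u , 0F)) ≡ reach ((v , i) ⊟ from (u , 0F))
      reach-pullback i u = trans (cong (λ y → reach (to (v , i) ⊟ y)) (sym (strictlyInverseˡ (u , 0F))))
                                 (reach-invariant {φ} φ-aut (v , i) (from (u , 0F)))

      same-neighbours : ∀ u → does (S? (a - u)) ≡ does (S? (b - u))
      same-neighbours u = begin
        does (S? (a - u))                 ≡⟨ reach-fibre (to (v , 0F) ⊟ (u , 0F)) ⟨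
        reach (to (v , 0F) ⊟ (u , 0F))    ≡⟨ reach-pullback 0F u ⟩
        reach ((v , 0F) ⊟ from (u , 0F))  ≡⟨ trans (reach-fibre ((v , 0F) ⊟ from (u , 0F)))
                                                   (sym (reach-fibre ((v , 1F) ⊟ from (u , 0F)))) ⟩
        reach ((v , 1F) ⊟ from (u , 0F))  ≡⟨ reach-pullback 1F u ⟨
        reach (to (v , 1F) ⊟ (u , 0F))    ≡⟨ reach-fibre (to (v , 1F) ⊟ (u , 0F)) ⟩
        does (S? (b - u))                 ∎

  -- S need not be decidable, but the goal is a decidable equation, and on the finite type A
  -- decidability of S holds up to double negation.
  isAutomorphism⇒fibrePreserving : (S : A → Set) → TwinFree (CayAdj _∙_ S) →
                                   ∀ {φ} → IsAutomorphism (BAdj (CayAdj _∙_ S)) φ → FibrePreserving φ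
  isAutomorphism⇒fibrePreserving S twinFree {φ} φ-aut v =
    decidable-stable (_ ParityA.≟ _) λ φ-splits-fibre →
      ¬¬-decidable enum S λ S? →
        φ-splits-fibre (Walks.isAutomorphism⇒fibrePreserving S? twinFree {φ} φ-aut v)

theorem1p1 : {A : Set} (_+_ : Op₂ A) (0# : A) (-_ : Op₁ A) →
    IsAbelianGroup _≡_ _+_ 0# -_ →
    (n : ℕ) → A ↔ Fin n → Odd n →
    (S : A → Set) → Symmetric -_ S →
    Connected (CayAdj _+_ S) → TwinFree (CayAdj _+_ S) →
    ((φ : (A × Fin 2) ↔ (A × Fin 2)) → IsAutomorphism (BAdj (CayAdj _+_ S)) φ →
      Σ (A ↔ A) λ α → IsAutomorphism (CayAdj _+_ S) α × Σ (Fin 2 ↔ Fin 2) λ σ →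
        ∀ v i → Inverse.to φ (v , i) ≡ (Inverse.to α v , Inverse.to σ i))
    ×
    ((α : A ↔ A) → IsAutomorphism (CayAdj _+_ S) α → (σ : Fin 2 ↔ Fin 2) →
      Σ ((A × Fin 2) ↔ (A × Fin 2)) λ φ → IsAutomorphism (BAdj (CayAdj _+_ S)) φ ×
        (∀ v i → Inverse.to φ (v , i) ≡ (Inverse.to α v , Inverse.to σ i)))
theorem1p1 _+_ 0# -_ isAbelianGroup n enum odd S _ connected twinFree =
  (λ φ φ-aut → fibrePreserving⇒product connected 0# φ φ-aut
                 (isAutomorphism⇒fibrePreserving S twinFree {φ} φ-aut))
  , λ α α-aut σ → (α ×-↔ σ) , product-isAutomorphism {α} α-aut σ , λ _ _ → refl
  where
  open OddAbelian isAbelianGroup enum odd using (isAutomorphism⇒fibrePreserving)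
  open DoubleCover (CayAdj _+_ S)
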